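{- Let $p$ be a prime and let $a\ge 2$, $b\ge 0$, $c\ge 2$ be integers with $p>a$. Let $(i,j)\in\mathcal{N}$. Let $u_j,v_j$ be the unique integers with $j-1+(a-1)(p-1)=p(u_j-1)+av_j$, $1\le u_j\le a$, $0\le v_j\le p-1$. Let $k_0,\dots,k_c$ be integers with $0\le k_0,\dots,k_c\le v_j$, $k_0+k_1+\dots+k_c=v_j$, and $p\mid bv_j+ck_c+(c-1)k_{c-1}+\dots+k_1+i$, and put \[ s_{i,j}(k_0,\dots,k_c)=\frac{bv_j+ck_c+(c-1)k_{c-1}+\dots+k_1+i}{p}. \] If $1\le s_{i,j}(k_0,\dots,k_c)\le b$, then \[ \left\lfloor -\frac{a}{b}\,s_{i,j}(k_0,\dots,k_c)+a\right\rfloor+1\le u_j . \]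
   Context: $\mathcal{N}$ denotes the set of lattice points in the interior of the Newton polygon of $y^a-x^bf(x)$ with $\deg f=c$, $f(0)\neq 0$, namely \[ \mathcal{N}=\Big\{(i,j)\in\mathbb{Z}^2:\ \big(1\le i\le b\ \text{and}\ \lfloor -\tfrac{a}{b}i+a\rfloor+1\le j\le\lceil -\tfrac{a}{b+c}i+a\rceil-1\big)\ \text{or}\ \big(b+1\le i\le b+c-1\ \text{and}\ 1\le j\le\lceil -\tfrac{a}{b+c}i+a\rceil-1\big)\Big\}. \] -}

module Defs where

open import Data.Nat as ℕ using (ℕ; zero; suc)
open import Data.Integer as ℤ using (ℤ; +_; _/ℕ_)
open import Data.Fin using (Fin; toℕ)
open import Data.List using (List; map; foldr; allFin)
open import Data.Product using (_×_)
open import Data.Sum using (_⊎_)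
import Data.Rational as ℚ

toℚ : ℤ → ℚ.ℚ
toℚ n = n ℚ./ 1

-- ⌊ -(a/d) x + a ⌋ ; only meaningful for d ≠ 0 (junk value 0 when d = 0,
-- never used: it is only evaluated under hypotheses forcing d ≥ 1)
floorLine : ℕ → ℕ → ℤ → ℤ
floorLine a zero    x = + 0
floorLine a (suc d) x =
  ℚ.⌊ ℚ.- ((+ a) ℚ./ suc d) ℚ.* toℚ x ℚ.+ toℚ (+ a) ⌋

-- ⌈ -(a/d) x + a ⌉ ; junk value 0 when d = 0 (never used since d = b+c ≥ 2)
ceilLine : ℕ → ℕ → ℤ → ℤ
ceilLine a zero    x = + 0
ceilLine a (suc d) x =
  ℚ.⌈ ℚ.- ((+ a) ℚ./ suc d) ℚ.* toℚ x ℚ.+ toℚ (+ a) ⌉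

-- The set 𝒩 of interior lattice points of the Newton polygon of y^a - x^b f(x), deg f = c
InN : (a b c : ℕ) → ℤ → ℤ → Set
InN a b c i j =
  ((+ 1 ℤ.≤ i × i ℤ.≤ + b) ×
     (floorLine a b i ℤ.+ + 1 ℤ.≤ j × j ℤ.≤ ceilLine a (b ℕ.+ c) i ℤ.- + 1))
  ⊎
  ((+ (b ℕ.+ 1) ℤ.≤ i × i ℤ.≤ + (b ℕ.+ c) ℤ.- + 1) ×
     (+ 1 ℤ.≤ j × j ℤ.≤ ceilLine a (b ℕ.+ c) i ℤ.- + 1))

sumℤ : List ℤ → ℤ
sumℤ = foldr ℤ._+_ (+ 0)

numer : (b c : ℕ) → ℤ → ℤ → (Fin (suc c) → ℤ) → ℤ
numer b c i v k =
  + b ℤ.* v ℤ.+ sumℤ (map (λ m → + toℕ m ℤ.* k m) (allFin (suc c))) ℤ.+ i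

-- s_{i,j}(k_0,…,k_c) = numer / p  (junk 0 for p = 0, excluded since p is prime)
sij : (p b c : ℕ) → ℤ → ℤ → (Fin (suc c) → ℤ) → ℤ
sij zero    b c i v k = + 0
sij (suc p) b c i v k = numer b c i v k /ℕ suc p

module Submission where

-- Write s = s_{i,j}(k) and S = Σ m·k_m, so that p·s = b·v + S + i.
-- For b ≥ 1 the claim ⌊-(a/b)s + a⌋ + 1 ≤ u says that the point (s,u) lies strictly
-- above the line through (0,a) and (b,0), i.e.  a·b < u·b + a·s.  Multiplying the
-- gap of this inequality by p and eliminating p·s and p·(u-1) + a·v with the two
-- defining relations gives the identity
--     p·((u·b + a·s) - a·b) = ((j·b + a·i) + a·S) - a·b ,
-- and the right-hand side is positive: S ≥ 0, and every interior point (i,j) of the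
-- Newton polygon lies strictly above that same line, j·b + a·i > a·b.  Cancelling p
-- proves the claim.

open import Defs
open import Data.Nat as ℕ using (ℕ; zero; suc; z≤n)
open import Data.Nat.Primality using (Prime)
open import Data.Integer as ℤ using (ℤ; +_; _+_; _*_; _-_; -_; _≤_; _<_; +≤+; +<+; 0ℤ)
open import Data.Integer.Divisibility using (_∣_)
open import Data.Integer.DivMod using (a≡a%n+[a/n]*n; [n/d]*d≤n; n%d<d; a≡a%ℕn+[a/ℕn]*n)
open import Data.Integer.Properties
open import Data.Integer.Tactic.RingSolver using (solve-∀)
open import Data.Fin using (Fin; toℕ)
open import Data.List using (List; []; _∷_; map; allFin)
open import Data.Product using (_,_)
open import Data.Sum using (inj₁; inj₂)
open import Function.Bundles using (_⇔_; mk⇔; Equivalence)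
open import Relation.Binary.PropositionalEquality
  using (_≡_; refl; sym; trans; cong; cong₂; subst; module ≡-Reasoning)
import Data.Nat.Divisibility as ℕ
import Data.Nat.Properties as ℕ
import Data.Rational as ℚ
import Data.Rational.Properties as ℚ
import Data.Rational.Unnormalised as ℚᵘ
import Data.Rational.Unnormalised.Properties as ℚᵘ

-- Two strict inequalities with the same difference are equivalent; this lets every
-- rearrangement of an inequality be reduced to a ring identity between differences.
<-by-difference : ∀ {i j i′ j′} → j - i ≡ j′ - i′ → i < j → i′ < j′
<-by-difference {i} {j} {i′} {j′} same i<j = begin-strict
  i′             ≡⟨ +-identityˡ i′ ⟨
  0ℤ + i′        ≡⟨ cong (_+ i′) (+-inverseʳ i) ⟨
  (i - i) + i′   <⟨ +-monoˡ-< i′ (+-monoˡ-< (- i) i<j) ⟩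
  (j - i) + i′   ≡⟨ cong (_+ i′) same ⟩
  (j′ - i′) + i′ ≡⟨ cancel j′ i′ ⟩
  j′             ∎
  where
  open ≤-Reasoning
  cancel : ∀ x y → (x - y) + y ≡ x
  cancel = solve-∀

0≤*0≤⇒0≤* : ∀ {x y} → 0ℤ ≤ x → 0ℤ ≤ y → 0ℤ ≤ x * y
0≤*0≤⇒0≤* {+ m} {+ n} _ _ = subst (0ℤ ≤_) (pos-* m n) (+≤+ z≤n)

[n/D]+1≤u⇔n<u*D : ∀ n d u → n ℤ./ + suc d + + 1 ≤ u ⇔ n < u * + suc d
[n/D]+1≤u⇔n<u*D n d u = mk⇔ to from
  where
  D = + suc d
  q = n ℤ./ D

  to : q + + 1 ≤ u → n < u * D
  to q+1≤u = begin-strict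
    n                   ≡⟨ a≡a%n+[a/n]*n n D ⟩
    + (n ℤ.% D) + q * D <⟨ +-monoˡ-< (q * D) (+<+ (n%d<d n D)) ⟩
    D + q * D           ≡⟨ shift D q ⟩
    (q + + 1) * D       ≤⟨ *-monoʳ-≤-nonNeg D q+1≤u ⟩
    u * D               ∎
    where
    open ≤-Reasoning
    shift : ∀ D q → D + q * D ≡ (q + + 1) * D
    shift = solve-∀

  from : n < u * D → q + + 1 ≤ u
  from n<uD = subst (_≤ u) (+-comm (+ 1) q)
    (i<j⇒suc[i]≤j {q} {u} (*-cancelʳ-<-nonNeg {q} {u} D (≤-<-trans ([n/d]*d≤n n D) n<uD)))

⌊q⌋+1≤u⇔q<u : ∀ q u → ℚ.floor q + + 1 ≤ u ⇔ ℚ.toℚᵘ q ℚᵘ.< ℚᵘ.mkℚᵘ u 0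
⌊q⌋+1≤u⇔q<u (ℚ.mkℚ n d _) u = mk⇔
  (λ h → ℚᵘ.*<* (subst (_< u * + suc d) (sym (*-identityʳ n)) (Equivalence.to iff h)))
  (λ { (ℚᵘ.*<* h) → Equivalence.from iff (subst (_< u * + suc d) (*-identityʳ n) h) })
  where
  iff = [n/D]+1≤u⇔n<u*D n d u

lineℚ : ℕ → ℕ → ℤ → ℚ.ℚ
lineℚ a d x = ℚ.- ((+ a) ℚ./ suc d) ℚ.* toℚ x ℚ.+ toℚ (+ a)

lineℚᵘ : ℕ → ℕ → ℤ → ℚᵘ.ℚᵘ
lineℚᵘ a d x = ℚᵘ.- ℚᵘ.mkℚᵘ (+ a) d ℚᵘ.* ℚᵘ.mkℚᵘ x 0 ℚᵘ.+ ℚᵘ.mkℚᵘ (+ a) 0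

line≃ : ∀ a d x → ℚ.toℚᵘ (lineℚ a d x) ℚᵘ.≃ ℚᵘ.mkℚᵘ (+ a * + suc d - + a * x) d
line≃ a d x = ℚᵘ.≃-trans homomorphic (ℚᵘ.*≡* cross)
  where
  A = + a
  D = + suc d

  homomorphic : ℚ.toℚᵘ (lineℚ a d x) ℚᵘ.≃ lineℚᵘ a d x
  homomorphic = ℚᵘ.≃-trans (ℚ.toℚᵘ-homo-+ (ℚ.- (A ℚ./ suc d) ℚ.* toℚ x) (toℚ A))
    (ℚᵘ.+-cong
       (ℚᵘ.≃-trans (ℚ.toℚᵘ-homo-* (ℚ.- (A ℚ./ suc d)) (toℚ x))
          (ℚᵘ.*-cong
             (ℚᵘ.≃-trans (ℚ.toℚᵘ-homo‿- (A ℚ./ suc d))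
                (ℚᵘ.-‿cong (ℚ.toℚᵘ-fromℚᵘ (ℚᵘ.mkℚᵘ A d))))
             (ℚ.toℚᵘ-fromℚᵘ (ℚᵘ.mkℚᵘ x 0))))
       (ℚ.toℚᵘ-fromℚᵘ (ℚᵘ.mkℚᵘ A 0)))

  unit₁ : + (suc d ℕ.* 1) ≡ D
  unit₁ = cong +_ (ℕ.*-identityʳ (suc d))
  unit₂ : + (suc d ℕ.* 1 ℕ.* 1) ≡ D
  unit₂ = cong +_ (trans (ℕ.*-identityʳ (suc d ℕ.* 1)) (ℕ.*-identityʳ (suc d)))

  clear : ∀ A D X → ((- A * X) * + 1 + A * D) * D ≡ (A * D - A * X) * D
  clear = solve-∀

  cross : ((- A * x) * + 1 + A * + (suc d ℕ.* 1)) * D ≡ (A * D - A * x) * + (suc d ℕ.* 1 ℕ.* 1)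
  cross = begin
    ((- A * x) * + 1 + A * + (suc d ℕ.* 1)) * D ≡⟨ cong (λ e → ((- A * x) * + 1 + A * e) * D) unit₁ ⟩
    ((- A * x) * + 1 + A * D) * D               ≡⟨ clear A D x ⟩
    (A * D - A * x) * D                         ≡⟨ cong ((A * D - A * x) *_) unit₂ ⟨
    (A * D - A * x) * + (suc d ℕ.* 1 ℕ.* 1)     ∎
    where open ≡-Reasoning

floorLine+1≤⇔ : ∀ a d x u → floorLine a (suc d) x + + 1 ≤ u ⇔ + a * + suc d < u * + suc d + + a * x
floorLine+1≤⇔ a d x u = mk⇔ to from
  where
  A = + a
  D = + suc d
  floorIff = ⌊q⌋+1≤u⇔q<u (lineℚ a d x) u

  gap : ∀ A D X u → u * D - (A * D - A * X) * + 1 ≡ (u * D + A * X) - A * D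
  gap = solve-∀

  to : floorLine a (suc d) x + + 1 ≤ u → A * D < u * D + A * x
  to h with ℚᵘ.<-respˡ-≃ (line≃ a d x) (Equivalence.to floorIff h)
  ... | ℚᵘ.*<* N<uD = <-by-difference (gap A D x u) N<uD

  from : A * D < u * D + A * x → floorLine a (suc d) x + + 1 ≤ u
  from h = Equivalence.from floorIff
    (ℚᵘ.<-respˡ-≃ (ℚᵘ.≃-sym (line≃ a d x)) (ℚᵘ.*<* (<-by-difference (sym (gap A D x u)) h)))

-- Interior lattice points of the Newton polygon lie strictly above the edge joining
-- (0,a) and (b,0):  a·b < j·b + a·i.  For 1 ≤ i ≤ b this is the lower bound on j; for
-- i > b it follows from a·i ≥ a·b and j ≥ 1.
interior-above-edge : ∀ a d c i j → InN a (suc d) c i j → + a * + suc d < j * + suc d + + a * i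
interior-above-edge a d c i j (inj₁ (_ , (j-above-floor , _))) =
  Equivalence.to (floorLine+1≤⇔ a d i j) j-above-floor
interior-above-edge a d c i j (inj₂ ((i-beyond-b , _) , (1≤j , _))) = begin-strict
  A * B             ≡⟨ +-identityʳ (A * B) ⟨
  A * B + 0ℤ        <⟨ +-monoʳ-< (A * B) (+<+ (ℕ.s≤s z≤n)) ⟩
  A * B + + 1 * B   ≤⟨ +-mono-≤ (*-monoˡ-≤-nonNeg A B≤i) (*-monoʳ-≤-nonNeg B 1≤j) ⟩
  A * i + j * B     ≡⟨ +-comm (A * i) (j * B) ⟩
  j * B + A * i     ∎
  where
  open ≤-Reasoning
  A = + a
  B = + suc d
  B≤i : B ≤ i
  B≤i = ≤-trans (+≤+ (ℕ.m≤m+n (suc d) 1)) i-beyond-b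

sum-nonNeg : ∀ {X : Set} (f : X → ℤ) (xs : List X) → (∀ x → 0ℤ ≤ f x) → 0ℤ ≤ sumℤ (map f xs)
sum-nonNeg f []       _   = +≤+ z≤n
sum-nonNeg f (x ∷ xs) f≥0 = +-mono-≤ (f≥0 x) (sum-nonNeg f xs f≥0)

∣⇒%ℕ≡0 : ∀ n d .{{_ : ℕ.NonZero d}} → + d ∣ n → n ℤ.%ℕ d ≡ 0
∣⇒%ℕ≡0 (+ m)     d d∣m = ℕ.n∣m⇒m%n≡0 m d d∣m
∣⇒%ℕ≡0 ℤ.-[1+ m ] d d∣m with suc m ℕ.% d | ℕ.n∣m⇒m%n≡0 (suc m) d d∣m
... | .0 | refl = refl

∣⇒[n/d]*d≡n : ∀ n d .{{_ : ℕ.NonZero d}} → + d ∣ n → (n ℤ./ℕ d) * + d ≡ n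
∣⇒[n/d]*d≡n n d d∣n = sym (begin
  n                                ≡⟨ a≡a%ℕn+[a/ℕn]*n n d ⟩
  + (n ℤ.%ℕ d) + (n ℤ./ℕ d) * + d  ≡⟨ cong (λ r → + r + (n ℤ./ℕ d) * + d) (∣⇒%ℕ≡0 n d d∣n) ⟩
  + 0 + (n ℤ./ℕ d) * + d           ≡⟨ +-identityˡ _ ⟩
  (n ℤ./ℕ d) * + d                 ∎)
  where open ≡-Reasoning

scaled-gap : ∀ P A B s u v i j S →
  s * P ≡ B * v + S + i →
  j - + 1 + (A - + 1) * (P - + 1) ≡ P * (u - + 1) + A * v →
  P * (u * B + A * s) - P * (A * B) ≡ (j * B + A * i + A * S) - A * B
scaled-gap P A B s u v i j S sP≡ uv≡ = begin
  P * (u * B + A * s) - P * (A * B)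
    ≡⟨ expand P A B s u v ⟩
  B * (P * (u - + 1) + A * v) + A * (s * P) + P * B - P * (A * B) - A * B * v
    ≡⟨ cong₂ (λ e n → B * e + A * n + P * B - P * (A * B) - A * B * v) (sym uv≡) sP≡ ⟩
  B * (j - + 1 + (A - + 1) * (P - + 1)) + A * (B * v + S + i) + P * B - P * (A * B) - A * B * v
    ≡⟨ collect P A B s v i j S ⟩
  (j * B + A * i + A * S) - A * B ∎
  where
  open ≡-Reasoning
  expand : ∀ P A B s u v → P * (u * B + A * s) - P * (A * B) ≡
    B * (P * (u - + 1) + A * v) + A * (s * P) + P * B - P * (A * B) - A * B * v
  expand = solve-∀
  collect : ∀ P A B s v i j S →
    B * (j - + 1 + (A - + 1) * (P - + 1)) + A * (B * v + S + i) + P * B - P * (A * B) - A * B * v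
      ≡ (j * B + A * i + A * S) - A * B
  collect = solve-∀

-- The case p = 0 is excluded by a < p and b = 0 by 1 ≤ s ≤ b; for
-- b ≥ 1 the goal is the inequality a·b < u·b + a·s, obtained by cancelling p from
-- the central identity, whose right-hand side is positive.
lemma3p5 : (p a b c : ℕ) → Prime p → 2 ℕ.≤ a → 2 ℕ.≤ c → a ℕ.< p →
    (i j : ℤ) → InN a b c i j →
    (u v : ℤ) →
    j ℤ.- + 1 ℤ.+ (+ a ℤ.- + 1) ℤ.* (+ p ℤ.- + 1) ≡ + p ℤ.* (u ℤ.- + 1) ℤ.+ + a ℤ.* v →
    + 1 ℤ.≤ u → u ℤ.≤ + a → + 0 ℤ.≤ v → v ℤ.≤ + p ℤ.- + 1 →
    (k : Fin (suc c) → ℤ) →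
    (∀ m → + 0 ℤ.≤ k m) → (∀ m → k m ℤ.≤ v) →
    sumℤ (map k (allFin (suc c))) ≡ v →
    (+ p) ∣ numer b c i v k →
    + 1 ℤ.≤ sij p b c i v k → sij p b c i v k ℤ.≤ + b →
    floorLine a b (sij p b c i v k) ℤ.+ + 1 ℤ.≤ u
lemma3p5 zero _ _ _ _ _ _ () _ _ _ _ _ _ _ _ _ _ _ _ _ _ _ _ _
lemma3p5 (suc _) _ zero _ _ _ _ _ _ _ _ _ _ _ _ _ _ _ _ _ _ _ _ 1≤s s≤0 with ≤-trans 1≤s s≤0
... | +≤+ ()
lemma3p5 p@(suc _) a b@(suc d) c _ _ _ _ i j ij∈𝒩 u v uv≡ _ _ _ _ k k≥0 _ _ p∣numer _ _ =
  Equivalence.from (floorLine+1≤⇔ a d s u) above-edge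
  where
  s = sij p b c i v k
  weighted : Fin (suc c) → ℤ
  weighted m = + toℕ m * k m
  S = sumℤ (map weighted (allFin (suc c)))

  sP≡ : s * + p ≡ + b * v + S + i
  sP≡ = ∣⇒[n/d]*d≡n (numer b c i v k) p p∣numer

  0≤aS : 0ℤ ≤ + a * S
  0≤aS = 0≤*0≤⇒0≤* {+ a} (+≤+ z≤n) (sum-nonNeg weighted (allFin (suc c))
    (λ m → 0≤*0≤⇒0≤* {+ toℕ m} (+≤+ z≤n) (k≥0 m)))

  ij-above-edge : + a * + b < j * + b + + a * i + + a * S
  ij-above-edge = <-≤-trans (interior-above-edge a d c i j ij∈𝒩) (i≤i+j _ _ {{ℤ.nonNegative 0≤aS}})

  above-edge : + a * + b < u * + b + + a * s
  above-edge = *-cancelˡ-<-nonNeg (+ p)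
    (<-by-difference (sym (scaled-gap (+ p) (+ a) (+ b) s u v i j S sP≡ uv≡)) ij-above-edge)
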